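{- Let $G$ be an almost hypocyclic graph with exceptional vertex $w$. Then for any partition $(W,X)$ of the vertex set of $G$ with $|W| > 1$ and $|X| > 1$, we have $p(G[W]) < |X|$ and $k(G[W]) < |X|$.
   Context: Graphs are finite, simple, undirected. A graph is hamiltonian if it has a cycle through all vertices. A graph $G$ is almost hypocyclic if there is a vertex $w$ (the exceptional vertex) such that $G - w$ is non-hamiltonian but $G - v$ is hamiltonian for every vertex $v \ne w$. For $S \subseteq V(G)$, $G[S]$ is the induced subgraph. For a possibly disconnected graph $F$, $p(F)$ is the minimum number of vertex-disjoint paths needed to cover all vertices of $F$; $V_1(F)$ is the set of vertices of degree $1$ in $F$; $I(F)$ is the set of all isolated vertices and all isolated edges (components isomorphic to $K_1$ or $K_2$) of $F$; and $k(F)$ is defined recursively by $k(F) = 0$ if $F$ is empty, $k(F) = \max\{1, \lceil |V_1(F)|/2 \rceil\}$ if $I(F) = \emptyset$ but $F$ is non-empty, and $k(F) = |I(F)| + k(F - I(F))$ otherwise, where $|I(F)|$ counts the isolated vertices and isolated edges and $F - I(F)$ removes these components. -}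

module Defs where

open import Data.Nat using (ℕ; zero; suc; _+_; _≤_; _<_; _≡ᵇ_; _/_; ⌈_/2⌉; _⊔_)
open import Data.Bool using (Bool; true; false; _∧_; not; if_then_else_)
open import Data.Fin using (Fin)
open import Data.Fin.Subset using (Subset; _∈_; _∩_; _∪_; _─_; _-_; ⊤; ∣_∣; Nonempty)
open import Data.Vec using (lookup; tabulate)
open import Data.List using (List; []; _∷_; _++_; [_]; length; concat)
open import Data.List.Relation.Unary.All using (All)
open import Data.List.Relation.Unary.Unique.Propositional using (Unique)
import Data.List.Membership.Propositional as LM
open import Data.Product using (Σ; _×_; ∃; _,_)
open import Relation.Binary.PropositionalEquality using (_≡_; _≢_)
open import Function.Bundles using (_⇔_)
open import Relation.Nullary using (¬_)

record Graph (n : ℕ) : Set where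
  field
    adj    : Fin n → Fin n → Bool
    sym    : ∀ u v → adj u v ≡ adj v u
    irrefl : ∀ v → adj v v ≡ false
open Graph public

module _ {n : ℕ} (G : Graph n) where

  data Chain : List (Fin n) → Set where
    chain[]  : Chain []
    chain[_] : ∀ x → Chain (x ∷ [])
    chain∷   : ∀ {x y r} → adj G x y ≡ true → Chain (y ∷ r) → Chain (x ∷ y ∷ r)

  Hamiltonian : Subset n → Set
  Hamiltonian S = Σ (Fin n) λ x → Σ (List (Fin n)) λ xs →
      Unique (x ∷ xs)
    × (∀ v → (v LM.∈ (x ∷ xs)) ⇔ (v ∈ S))
    × 3 ≤ length (x ∷ xs)
    × Chain (x ∷ xs ++ [ x ])

  AlmostHypocyclicWith : Fin n → Set
  AlmostHypocyclicWith w =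
    ¬ Hamiltonian (⊤ - w) × (∀ v → v ≢ w → Hamiltonian (⊤ - v))

  -- a path is a non-empty list of distinct vertices, consecutive ones adjacent
  NonEmptyList : List (Fin n) → Set
  NonEmptyList []      = Data.Empty.⊥ where import Data.Empty
  NonEmptyList (_ ∷ _) = Data.Unit.⊤ where import Data.Unit

  PathCover : Subset n → List (List (Fin n)) → Set
  PathCover S ps =
      All NonEmptyList ps
    × All Chain ps
    × Unique (concat ps)
    × (∀ v → (v LM.∈ concat ps) ⇔ (v ∈ S))

  PathCoverNumber : Subset n → ℕ → Set
  PathCoverNumber S m =
      (Σ (List (List (Fin n))) λ ps → PathCover S ps × length ps ≡ m)
    × (∀ ps → PathCover S ps → m ≤ length ps)

  nbrs : Fin n → Subset n
  nbrs v = tabulate (adj G v)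

  deg : Subset n → Fin n → ℕ
  deg S v = ∣ S ∩ nbrs v ∣

  V₁ : Subset n → Subset n
  V₁ S = tabulate λ v → lookup S v ∧ (deg S v ≡ᵇ 1)

  Iso : Subset n → Subset n
  Iso S = tabulate λ v → lookup S v ∧ (deg S v ≡ᵇ 0)

  -- vertices lying on isolated edges (K2 components) of G[S]:
  -- degree 1, and its unique neighbour also has degree 1
  allFinB : (Fin n → Bool) → Bool
  allFinB f = ∣ tabulate (λ u → not (f u)) ∣ ≡ᵇ 0

  IEv : Subset n → Subset n
  IEv S = tabulate λ v → lookup S v ∧ (deg S v ≡ᵇ 1)
           ∧ allFinB (λ u → if lookup S u ∧ adj G v u then deg S u ≡ᵇ 1 else true)

  Iset : Subset n → Subset n
  Iset S = Iso S ∪ IEv S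

  -- |I(G[S])| : number of isolated vertices plus number of isolated edges
  Icount : Subset n → ℕ
  Icount S = ∣ Iso S ∣ + ∣ IEv S ∣ / 2

  data KValue : Subset n → ℕ → Set where
    k-empty : ∀ {S} → ∣ S ∣ ≡ 0 → KValue S 0
    k-noI   : ∀ {S} → Nonempty S → ∣ Iset S ∣ ≡ 0 →
              KValue S (1 ⊔ ⌈ ∣ V₁ S ∣ /2⌉)
    k-I     : ∀ {S m} → ∣ Iset S ∣ ≢ 0 → KValue (S ─ Iset S) m →
              KValue S (Icount S + m)

module Submission where

-- Take v₀ ∈ X other than w. Then G − v₀ has a Hamiltonian cycle; open it at a second vertex
-- y ∈ X and cut it at the vertices of X. The pieces are paths of G[W] covering W, and there are
-- at most as many of them as vertices of X on the cycle, i.e. at most |X| − 1; so p(G[W]) < |X|.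
--
-- For k, we show k(F) ≤ (number of paths) for every path cover of every graph F, by following the
-- recursion defining k. A degree-1 vertex of F can only be an end of its path, so |V₁(F)| is at
-- most twice the number of paths. Since I(F) is a union of components, every path meeting I(F)
-- lies inside it, and is either a single isolated vertex or lies on an isolated edge; the other
-- paths form a path cover of F − I(F).

open import Defs hiding (sym)

open import Data.Bool using (Bool; true; false; T; not; _∧_; if_then_else_)
open import Data.Bool.Properties using (T-≡; T-∧; T-not-≡)
open import Data.Empty using (⊥-elim)
open import Data.Fin using (Fin; zero; suc; _≟_)
open import Data.Fin.Subset
  using (Subset; _∈_; _∉_; _─_; _-_; ⁅_⁆; ∣_∣; Empty; ⊤; ∁; _∩_; outside; inside)
open import Data.Fin.Subset.Properties
  using ( _∈?_; nonempty?; ∈⊤; drop-there; x∈⁅x⁆; x∉⁅y⁆⇒x≢y; x∈p∩q⁺; x∈p∪q⁺; x∈p∪q⁻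
        ; x∉∁p⇒x∈p; x∈p⇒x∉∁p; p─q⊆p; x∈p∧x∉q⇒x∈p─q; x∈p∧x≢y⇒x∈p-y
        ; p⊆q⇒∣p∣≤∣q∣; x∈p⇒∣p-x∣<∣p∣; Empty-unique; ∣⊥∣≡0)
open import Data.List using (List; []; _∷_; _++_; [_]; length; concat; filter)
open import Data.List.Properties
  using (filter-++; filter-all; filter-none; filter-accept; length-filter; length-++; ++-assoc; ++-identityʳ)
open import Data.List.Membership.Propositional using (lose) renaming (_∈_ to _∈ₗ_)
open import Data.List.Membership.Propositional.Properties
  using (∈-concat⁺′; ∈-concat⁻′; ∈-filter⁺; ∈-filter⁻; ∈-∃++)
open import Data.List.Relation.Unary.All using (All; []; _∷_)
import Data.List.Relation.Unary.All as All
open import Data.List.Relation.Unary.All.Properties using (¬Any⇒All¬)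
import Data.List.Relation.Unary.All.Properties as All
open import Data.List.Relation.Unary.AllPairs using ([]; _∷_)
open import Data.List.Relation.Unary.Any using (Any; here; there; any?)
open import Data.List.Relation.Unary.Unique.Propositional using (Unique)
import Data.List.Relation.Unary.Unique.Propositional.Properties as Unique
open import Data.List.Relation.Binary.Permutation.Propositional using (_↭_; ↭-sym; ↭⇒↭ₛ)
open import Data.List.Relation.Binary.Permutation.Propositional.Properties using (++-comm; ∈-resp-↭)
import Data.List.Relation.Binary.Permutation.Setoid.Properties as Permutationₛ
open import Data.Nat using (ℕ; zero; suc; _+_; _*_; _/_; _≤_; _<_; _≡ᵇ_; z≤n; s≤s; ⌈_/2⌉)
open import Data.Nat.Properties
  using ( ≤-refl; ≤-reflexive; ≤-trans; ≤-<-trans; <⇒≱; 1+n≰n; n≤1+n; +-suc; +-identityʳ; *-comm; *-suc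
        ; +-mono-≤; *-monoʳ-≤; ⊔-lub; ≡ᵇ⇒≡; ≡⇒≡ᵇ; ⌈n/2⌉-mono; n≡⌈n+n/2⌉; module ≤-Reasoning)
open import Data.Nat.DivMod using (m*n/n≡m; +-distrib-/-∣ˡ; /-monoˡ-≤)
open import Data.Nat.Divisibility using (divides)
open import Data.Nat.Tactic.RingSolver using (solve-∀)
open import Data.Product using (∃-syntax; _×_; _,_; proj₁; proj₂; map₁; map₂; uncurry)
open import Data.Sum using (_⊎_; inj₁; inj₂)
open import Data.Vec using (lookup; tabulate; _∷_)
import Data.Vec as Vec
open import Data.Vec.Properties using ([]=⇒lookup; lookup⇒[]=; lookup∘tabulate)
open import Function using (_∘_; case_of_; _⇔_; Equivalence; mk⇔)
open import Relation.Binary.PropositionalEquality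
  using (_≡_; _≢_; refl; sym; trans; cong; cong₂; subst; module ≡-Reasoning)
open import Relation.Binary.PropositionalEquality.Properties using (setoid)
open import Relation.Nullary using (¬_; yes; no; contradiction)
open import Relation.Unary using (Pred; Decidable)
open import Relation.Unary.Properties using (∁?)

private variable
  n : ℕ
  p q : Subset n
  x y : Fin n

x∈p─q⇒x∉q : x ∈ p ─ q → x ∉ q
x∈p─q⇒x∉q {p = _ ∷ _} {q = outside ∷ _} (Vec.there x∈p─q) (Vec.there x∈q) = x∈p─q⇒x∉q x∈p─q x∈q
x∈p─q⇒x∉q {p = _ ∷ _} {q = inside  ∷ _} (Vec.there x∈p─q) (Vec.there x∈q) = x∈p─q⇒x∉q x∈p─q x∈q

∣x∷p∣≤1+∣p∣ : ∀ s (p : Subset n) → ∣ s ∷ p ∣ ≤ suc ∣ p ∣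
∣x∷p∣≤1+∣p∣ inside  p = ≤-refl
∣x∷p∣≤1+∣p∣ outside p = n≤1+n ∣ p ∣

∣p∣≤1+∣p-x∣ : ∀ (p : Subset n) x → ∣ p ∣ ≤ suc ∣ p - x ∣
∣p∣≤1+∣p-x∣ (s ∷ p) zero = ≤-trans (∣x∷p∣≤1+∣p∣ s p) (s≤s (p⊆q⇒∣p∣≤∣q∣ λ y∈p →
  drop-there (x∈p∧x≢y⇒x∈p-y {p = s ∷ p} {y = zero} (Vec.there y∈p) λ ())))
∣p∣≤1+∣p-x∣ (inside  ∷ p) (suc x) = s≤s (∣p∣≤1+∣p-x∣ p x)
∣p∣≤1+∣p-x∣ (outside ∷ p) (suc x) = ∣p∣≤1+∣p-x∣ p x

Empty⇒∣p∣≡0 : ∀ {n} {p : Subset n} → Empty p → ∣ p ∣ ≡ 0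
Empty⇒∣p∣≡0 {n} empty rewrite Empty-unique empty = ∣⊥∣≡0 n

Unique⇒length≤∣p∣ : ∀ {xs} → Unique xs → All (_∈ p) xs → length xs ≤ ∣ p ∣
Unique⇒length≤∣p∣ []              []              = z≤n
Unique⇒length≤∣p∣ {p = p} {x ∷ _} (x∉xs ∷ !xs) (x∈p ∷ xs⊆p) =
  ≤-trans (s≤s (Unique⇒length≤∣p∣ !xs (All.zipWith ∈p-x (x∉xs , xs⊆p)))) (x∈p⇒∣p-x∣<∣p∣ x∈p)
  where
  ∈p-x : ∀ {y} → x ≢ y × y ∈ p → y ∈ p - x
  ∈p-x (x≢y , y∈p) = x∈p∧x≢y⇒x∈p-y y∈p (x≢y ∘ sym)

∣p∣≤length : ∀ (p : Subset n) xs → (∀ {x} → x ∈ p → x ∈ₗ xs) → ∣ p ∣ ≤ length xs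
∣p∣≤length p []       p⊆[]   = ≤-reflexive (Empty⇒∣p∣≡0 λ (_ , x∈p) → case p⊆[] x∈p of λ ())
∣p∣≤length p (x ∷ xs) p⊆x∷xs = ≤-trans (∣p∣≤1+∣p-x∣ p x) (s≤s (∣p∣≤length (p - x) xs p-x⊆xs))
  where
  p-x⊆xs : ∀ {y} → y ∈ p - x → y ∈ₗ xs
  p-x⊆xs y∈p-x with p⊆x∷xs (p─q⊆p p ⁅ x ⁆ y∈p-x)
  ... | here refl  = contradiction (x∈⁅x⁆ x) (x∈p─q⇒x∉q y∈p-x)
  ... | there y∈xs = y∈xs

∣p∣≡0⇒x∉p : ∣ p ∣ ≡ 0 → x ∉ p
∣p∣≡0⇒x∉p ∣p∣≡0 x∈p = 1+n≰n (subst (1 ≤_) ∣p∣≡0 (Unique⇒length≤∣p∣ ([] ∷ []) (x∈p ∷ [])))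

1<∣p∣⇒∃x≢y : ∀ (p : Subset n) y → 1 < ∣ p ∣ → ∃[ x ] x ∈ p × x ≢ y
1<∣p∣⇒∃x≢y p y 1<∣p∣ with nonempty? (p - y)
... | yes (x , x∈p-y) = x , p─q⊆p p ⁅ y ⁆ x∈p-y , x∉⁅y⁆⇒x≢y (x∈p─q⇒x∉q x∈p-y)
... | no  empty       =
  contradiction (subst (λ k → ∣ p ∣ ≤ suc k) (Empty⇒∣p∣≡0 empty) (∣p∣≤1+∣p-x∣ p y)) (<⇒≱ 1<∣p∣)

∈⇔T-lookup : x ∈ p ⇔ T (lookup p x)
∈⇔T-lookup {x = x} {p = p} = mk⇔ (Equivalence.from T-≡ ∘ []=⇒lookup) (lookup⇒[]= x p ∘ Equivalence.to T-≡)

∈-tabulate⁻ : ∀ {f : Fin n → Bool} → x ∈ tabulate f → T (f x)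
∈-tabulate⁻ {x = x} {f} x∈ = subst T (lookup∘tabulate f x) (Equivalence.to ∈⇔T-lookup x∈)

∈-tabulate⁺ : ∀ {f : Fin n → Bool} → T (f x) → x ∈ tabulate f
∈-tabulate⁺ {x = x} {f} fx = Equivalence.from ∈⇔T-lookup (subst T (sym (lookup∘tabulate f x)) fx)

count∈ : Subset n → List (Fin n) → ℕ
count∈ p xs = length (filter (_∈? p) xs)

∣p∣≤count∈ : ∀ (p : Subset n) xs → (∀ {x} → x ∈ p → x ∈ₗ xs) → ∣ p ∣ ≤ count∈ p xs
∣p∣≤count∈ p xs p⊆xs = ∣p∣≤length p (filter (_∈? p) xs) λ x∈p → ∈-filter⁺ (_∈? p) (p⊆xs x∈p) x∈p

count∈-++ : ∀ (p : Subset n) xs ys → count∈ p (xs ++ ys) ≡ count∈ p xs + count∈ p ys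
count∈-++ p xs ys = trans (cong length (filter-++ (_∈? p) xs ys)) (length-++ (filter (_∈? p) xs))

weighted-count-concat : ∀ (p q : Subset n) xss →
                        (∀ {xs} → xs ∈ₗ xss → 2 * count∈ p xs + count∈ q xs ≤ 2) →
                        2 * count∈ p (concat xss) + count∈ q (concat xss) ≤ 2 * length xss
weighted-count-concat p q []         _     = z≤n
weighted-count-concat p q (xs ∷ xss) bound = begin
  2 * count∈ p (xs ++ concat xss) + count∈ q (xs ++ concat xss)
    ≡⟨ cong₂ (λ a b → 2 * a + b) (count∈-++ p xs (concat xss)) (count∈-++ q xs (concat xss)) ⟩
  2 * (count∈ p xs + count∈ p (concat xss)) + (count∈ q xs + count∈ q (concat xss))
    ≡⟨ regroup (count∈ p xs) _ (count∈ q xs) _ ⟩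
  (2 * count∈ p xs + count∈ q xs) + (2 * count∈ p (concat xss) + count∈ q (concat xss))
    ≤⟨ +-mono-≤ (bound (here refl)) (weighted-count-concat p q xss (bound ∘ there)) ⟩
  2 + 2 * length xss
    ≡⟨ *-suc 2 (length xss) ⟨
  2 * length (xs ∷ xss) ∎
  where
  open ≤-Reasoning
  regroup : ∀ a a′ b b′ → 2 * (a + a′) + (b + b′) ≡ (2 * a + b) + (2 * a′ + b′)
  regroup = solve-∀

2*n/2≡n : ∀ n → 2 * n / 2 ≡ n
2*n/2≡n n = trans (cong (_/ 2) (*-comm 2 n)) (m*n/n≡m n 2)

2*a+b≤2*q⇒a+b/2≤q : ∀ a b q → 2 * a + b ≤ 2 * q → a + b / 2 ≤ q
2*a+b≤2*q⇒a+b/2≤q a b q 2a+b≤2q = begin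
  a + b / 2         ≡⟨ cong (_+ b / 2) (2*n/2≡n a) ⟨
  2 * a / 2 + b / 2 ≡⟨ +-distrib-/-∣ˡ b (divides a (*-comm 2 a)) ⟨
  (2 * a + b) / 2   ≤⟨ /-monoˡ-≤ 2 2a+b≤2q ⟩
  2 * q / 2         ≡⟨ 2*n/2≡n q ⟩
  q                 ∎
  where open ≤-Reasoning

m≤2*q⇒⌈m/2⌉≤q : ∀ m q → m ≤ 2 * q → ⌈ m /2⌉ ≤ q
m≤2*q⇒⌈m/2⌉≤q m q m≤2q = ≤-trans (⌈n/2⌉-mono m≤2q)
  (≤-reflexive (sym (trans (n≡⌈n+n/2⌉ q) (cong (λ k → ⌈ q + k /2⌉) (sym (+-identityʳ q))))))

module _ {a} {A : Set a} where

  Unique-resp-↭ : ∀ {xs ys : List A} → xs ↭ ys → Unique xs → Unique ys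
  Unique-resp-↭ = Permutationₛ.Unique-resp-↭ (setoid A) ∘ ↭⇒↭ₛ

  Unique-++⁻ˡ : ∀ (xs : List A) {ys} → Unique (xs ++ ys) → Unique xs
  Unique-++⁻ˡ []       _             = []
  Unique-++⁻ˡ (x ∷ xs) (x∉xs ∷ !xs) = All.++⁻ˡ xs x∉xs ∷ Unique-++⁻ˡ xs !xs

  Unique-++⁻ʳ : ∀ (xs : List A) {ys} → Unique (xs ++ ys) → Unique ys
  Unique-++⁻ʳ []       !ys       = !ys
  Unique-++⁻ʳ (x ∷ xs) (_ ∷ !xs) = Unique-++⁻ʳ xs !xs

  Unique-concat⁻ : ∀ {xs : List A} {xss} → Unique (concat xss) → xs ∈ₗ xss → Unique xs
  Unique-concat⁻ {xss = xs ∷ _} !xss (here refl) = Unique-++⁻ˡ xs !xss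
  Unique-concat⁻ {xss = ys ∷ _} !xss (there xs∈) = Unique-concat⁻ (Unique-++⁻ʳ ys !xss) xs∈

  last′ : A → List A → A
  last′ x []       = x
  last′ _ (y ∷ ys) = last′ y ys

  endpoints : List (List A) → List A
  endpoints []               = []
  endpoints ([] ∷ xss)       = endpoints xss
  endpoints ((x ∷ xs) ∷ xss) = x ∷ last′ x xs ∷ endpoints xss

  length-endpoints : ∀ xss → length (endpoints xss) ≤ 2 * length xss
  length-endpoints []               = z≤n
  length-endpoints ([] ∷ xss)       = ≤-trans (length-endpoints xss) (*-monoʳ-≤ 2 (n≤1+n _))
  length-endpoints ((x ∷ xs) ∷ xss) = ≤-trans (s≤s (s≤s (length-endpoints xss))) (≤-reflexive (sym (*-suc 2 (length xss))))

  ∈-endpoints : ∀ {v x xs xss} → x ∷ xs ∈ₗ xss → v ≡ x ⊎ v ≡ last′ x xs → v ∈ₗ endpoints xss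
  ∈-endpoints {xss = _ ∷ _}       (here refl) (inj₁ refl) = here refl
  ∈-endpoints {xss = _ ∷ _}       (here refl) (inj₂ refl) = there (here refl)
  ∈-endpoints {xss = [] ∷ _}      (there xs∈) v-end       = ∈-endpoints xs∈ v-end
  ∈-endpoints {xss = (_ ∷ _) ∷ _} (there xs∈) v-end       = there (there (∈-endpoints xs∈ v-end))

  infixr 5 _∷?_
  _∷?_ : List A → List (List A) → List (List A)
  []          ∷? xss = xss
  xs@(_ ∷ _) ∷? xss = xs ∷ xss

  concat-∷? : ∀ xs xss → concat (xs ∷? xss) ≡ xs ++ concat xss
  concat-∷? []      xss = refl
  concat-∷? (_ ∷ _) xss = refl

  length-∷? : ∀ xs xss → length (xs ∷? xss) ≤ suc (length xss)
  length-∷? []      xss = n≤1+n _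
  length-∷? (_ ∷ _) xss = ≤-refl

  module _ {q} {Q : List A → Set q} where

    All-∷? : ∀ {xs xss} → Q xs → All Q xss → All Q (xs ∷? xss)
    All-∷? {xs = []}    _   Qxss = Qxss
    All-∷? {xs = _ ∷ _} Qxs Qxss = Qxs ∷ Qxss

    All-∷?-nonempty : (∀ {x xs} → Q (x ∷ xs)) → ∀ xs {xss} → All Q xss → All Q (xs ∷? xss)
    All-∷?-nonempty Q∷ []      Qxss = Qxss
    All-∷?-nonempty Q∷ (_ ∷ _) Qxss = Q∷ ∷ Qxss

  module _ {ℓ} {P : Pred A ℓ} (P? : Decidable P) where

    length-filter+length-filter-∁ : ∀ xs → length (filter P? xs) + length (filter (∁? P?) xs) ≡ length xs
    length-filter+length-filter-∁ []       = refl
    length-filter+length-filter-∁ (x ∷ xs) with P? x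
    ... | yes _ = cong suc (length-filter+length-filter-∁ xs)
    ... | no  _ = trans (+-suc _ _) (cong suc (length-filter+length-filter-∁ xs))

    concat-filter-∁-any : ∀ xss → All (λ xs → Any P xs → All P xs) xss →
                          concat (filter (∁? (any? P?)) xss) ≡ filter (∁? P?) (concat xss)
    concat-filter-∁-any []         []                 = refl
    concat-filter-∁-any (xs ∷ xss) (all-if-any ∷ rest) with any? P? xs
    ... | yes some = begin
      concat (filter (∁? (any? P?)) xss)               ≡⟨ concat-filter-∁-any xss rest ⟩
      filter (∁? P?) (concat xss)                      ≡⟨ cong (_++ _) none-left ⟨
      filter (∁? P?) xs ++ filter (∁? P?) (concat xss) ≡⟨ filter-++ (∁? P?) xs (concat xss) ⟨
      filter (∁? P?) (xs ++ concat xss)                ∎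
      where
      open ≡-Reasoning
      none-left : filter (∁? P?) xs ≡ []
      none-left = filter-none (∁? P?) (All.map (λ Px ¬Px → ¬Px Px) (all-if-any some))
    ... | no none = begin
      xs ++ concat (filter (∁? (any? P?)) xss)         ≡⟨ cong (xs ++_) (concat-filter-∁-any xss rest) ⟩
      xs ++ filter (∁? P?) (concat xss)                ≡⟨ cong (_++ _) (filter-all (∁? P?) (¬Any⇒All¬ xs none)) ⟨
      filter (∁? P?) xs ++ filter (∁? P?) (concat xss) ≡⟨ filter-++ (∁? P?) xs (concat xss) ⟨
      filter (∁? P?) (xs ++ concat xss)                ∎
      where open ≡-Reasoning

    -- runs xs = (the leading P-free infix of xs, possibly empty; the later maximal P-free infixes)
    runs : List A → List A × List (List A)
    runs []       = [] , []
    runs (x ∷ xs) with P? x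
    ... | yes _ = [] , uncurry _∷?_ (runs xs)
    ... | no  _ = map₁ (x ∷_) (runs xs)

    blocks : List A → List (List A)
    blocks xs = uncurry _∷?_ (runs xs)

    concat-blocks : ∀ xs → concat (blocks xs) ≡ filter (∁? P?) xs
    concat-blocks []       = refl
    concat-blocks (x ∷ xs) with P? x
    ... | yes _ = concat-blocks xs
    ... | no  _ = cong (x ∷_) (trans (sym (concat-∷? (proj₁ (runs xs)) (proj₂ (runs xs)))) (concat-blocks xs))

    length-runs : ∀ xs → length (proj₂ (runs xs)) ≤ length (filter P? xs)
    length-runs []       = z≤n
    length-runs (x ∷ xs) with P? x
    ... | yes _ = ≤-trans (length-∷? (proj₁ (runs xs)) (proj₂ (runs xs))) (s≤s (length-runs xs))
    ... | no  _ = length-runs xs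

    length-blocks : ∀ xs → length (blocks xs) ≤ suc (length (filter P? xs))
    length-blocks xs = ≤-trans (length-∷? (proj₁ (runs xs)) (proj₂ (runs xs))) (s≤s (length-runs xs))

    runs-prefix : ∀ xs → ∃[ ys ] xs ≡ proj₁ (runs xs) ++ ys
    runs-prefix []       = [] , refl
    runs-prefix (x ∷ xs) with P? x
    ... | yes _ = x ∷ xs , refl
    ... | no  _ = map₂ (cong (x ∷_)) (runs-prefix xs)

    module _ {q} {Q : List A → Set q} where

      runs-nonempty : (∀ {x xs} → Q (x ∷ xs)) → ∀ xs → All Q (proj₂ (runs xs))
      runs-nonempty Q∷ []       = []
      runs-nonempty Q∷ (x ∷ xs) with P? x
      ... | yes _ = All-∷?-nonempty Q∷ (proj₁ (runs xs)) (runs-nonempty Q∷ xs)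
      ... | no  _ = runs-nonempty Q∷ xs

      blocks-nonempty : (∀ {x xs} → Q (x ∷ xs)) → ∀ xs → All Q (blocks xs)
      blocks-nonempty Q∷ xs = All-∷?-nonempty Q∷ (proj₁ (runs xs)) (runs-nonempty Q∷ xs)

      module _ (Q[] : Q []) (Q-prefix : ∀ {xs ys} → Q (xs ++ ys) → Q xs) (Q-tail : ∀ {x xs} → Q (x ∷ xs) → Q xs) where

        runs-infix : ∀ {xs} → Q xs → Q (proj₁ (runs xs)) × All Q (proj₂ (runs xs))
        runs-infix {[]}     _   = Q[] , []
        runs-infix {x ∷ xs} Qxs with P? x | runs-infix (Q-tail Qxs)
        ... | yes _ | Qr , Qrs = Q[] , All-∷? Qr Qrs
        ... | no  _ | _  , Qrs = Q-prefix (subst Q (cong (x ∷_) (proj₂ (runs-prefix xs))) Qxs) , Qrs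

        blocks-infix : ∀ {xs} → Q xs → All Q (blocks xs)
        blocks-infix Qxs = uncurry All-∷? (runs-infix Qxs)

-- Chains, degrees and the isolated part I(G[S])

module _ (G : Graph n) where

  Adjacent : Fin n → Fin n → Set
  Adjacent x y = adj G x y ≡ true

  adjacent-sym : Adjacent x y → Adjacent y x
  adjacent-sym {x} {y} xy = trans (Graph.sym G y x) xy

  chain-++⁻ˡ : ∀ xs {ys} → Chain G (xs ++ ys) → Chain G xs
  chain-++⁻ˡ []           _             = chain[]
  chain-++⁻ˡ (x ∷ [])     _             = chain[ x ]
  chain-++⁻ˡ (x ∷ y ∷ xs) (chain∷ xy c) = chain∷ xy (chain-++⁻ˡ (y ∷ xs) c)

  chain-++⁻ʳ : ∀ xs {ys} → Chain G (xs ++ ys) → Chain G ys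
  chain-++⁻ʳ []                    c            = c
  chain-++⁻ʳ (x ∷ [])     {[]}     _            = chain[]
  chain-++⁻ʳ (x ∷ [])     {y ∷ ys} (chain∷ _ c) = c
  chain-++⁻ʳ (x ∷ y ∷ xs)          (chain∷ _ c) = chain-++⁻ʳ (y ∷ xs) c

  chain-++⁺ : ∀ xs {y ys} → Chain G (xs ++ [ y ]) → Chain G (y ∷ ys) → Chain G (xs ++ y ∷ ys)
  chain-++⁺ []            _              c = c
  chain-++⁺ (x ∷ [])      (chain∷ xy _)  c = chain∷ xy c
  chain-++⁺ (x ∷ x′ ∷ xs) (chain∷ xx′ c′) c = chain∷ xx′ (chain-++⁺ (x′ ∷ xs) c′ c)

  chain-rotate : ∀ {x xs} as y bs → x ∷ xs ≡ as ++ y ∷ bs → Chain G (x ∷ xs ++ [ x ]) → Chain G (y ∷ bs ++ as)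
  chain-rotate []       y bs refl c = subst (Chain G ∘ (y ∷_)) (sym (++-identityʳ bs)) (chain-++⁻ˡ (y ∷ bs) c)
  chain-rotate (a ∷ as) y bs refl c = chain-++⁺ (y ∷ bs) (chain-++⁻ʳ (a ∷ as) c′) (chain-++⁻ˡ (a ∷ as) c′)
    where
    c′ : Chain G ((a ∷ as) ++ y ∷ bs ++ [ a ])
    c′ = subst (Chain G ∘ (a ∷_)) (++-assoc as (y ∷ bs) [ a ]) c

  T-allFinB : ∀ (f : Fin n → Bool) → T (allFinB G f) ⇔ (∀ x → T (f x))
  T-allFinB f = mk⇔ all-hold none-fails
    where
    failures : Subset n
    failures = tabulate (not ∘ f)

    all-hold : T (allFinB G f) → ∀ x → T (f x)
    all-hold no-failures x with f x in fx
    ... | true  = _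
    ... | false = ⊥-elim (∣p∣≡0⇒x∉p {p = failures} (≡ᵇ⇒≡ ∣ failures ∣ 0 no-failures)
                                      (∈-tabulate⁺ {f = not ∘ f} (subst (T ∘ not) (sym fx) _)))

    none-fails : (∀ x → T (f x)) → T (allFinB G f)
    none-fails hold = ≡⇒≡ᵇ ∣ failures ∣ 0
      (Empty⇒∣p∣≡0 λ (x , x∈) → subst T (Equivalence.to T-not-≡ (∈-tabulate⁻ x∈)) (hold x))

  module _ (S : Subset n) where

    ∈-nbrs : y ∈ S → Adjacent x y → y ∈ S ∩ nbrs G x
    ∈-nbrs y∈S xy = x∈p∩q⁺ (y∈S , ∈-tabulate⁺ (Equivalence.from T-≡ xy))

    1≤deg : y ∈ S → Adjacent x y → 1 ≤ deg G S x
    1≤deg y∈S xy = Unique⇒length≤∣p∣ ([] ∷ []) (∈-nbrs y∈S xy ∷ [])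

    2≤deg : ∀ {y z} → y ∈ S → z ∈ S → Adjacent x y → Adjacent x z → y ≢ z → 2 ≤ deg G S x
    2≤deg y∈S z∈S xy xz y≢z = Unique⇒length≤∣p∣ ((y≢z ∷ []) ∷ [] ∷ []) (∈-nbrs y∈S xy ∷ ∈-nbrs z∈S xz ∷ [])

    deg≡1⇒unique-nbr : ∀ {y z} → deg G S x ≡ 1 → y ∈ S → z ∈ S → Adjacent x y → Adjacent x z → y ≡ z
    deg≡1⇒unique-nbr {y = y} {z} deg≡1 y∈S z∈S xy xz with y ≟ z
    ... | yes y≡z = y≡z
    ... | no  y≢z = contradiction (subst (2 ≤_) deg≡1 (2≤deg y∈S z∈S xy xz y≢z)) (<⇒≱ ≤-refl)

    ∈-deg-class⁻ : ∀ {k} → x ∈ tabulate (λ v → lookup S v ∧ (deg G S v ≡ᵇ k)) → x ∈ S × deg G S x ≡ k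
    ∈-deg-class⁻ {k = k} x∈ with x∈S , deg≡k ← Equivalence.to T-∧ (∈-tabulate⁻ x∈) =
      Equivalence.from ∈⇔T-lookup x∈S , ≡ᵇ⇒≡ _ k deg≡k

    ∈Iso⁻ : x ∈ Iso G S → x ∈ S × deg G S x ≡ 0
    ∈Iso⁻ = ∈-deg-class⁻

    ∈V₁⁻ : x ∈ V₁ G S → x ∈ S × deg G S x ≡ 1
    ∈V₁⁻ = ∈-deg-class⁻

    not-isolated : y ∈ S → Adjacent x y → x ∉ Iso G S
    not-isolated y∈S xy x∈Iso = contradiction (subst (1 ≤_) (proj₂ (∈Iso⁻ x∈Iso)) (1≤deg y∈S xy)) λ ()

    OnIsolatedEdge : Fin n → Set
    OnIsolatedEdge x = x ∈ S × deg G S x ≡ 1 × (∀ {y} → y ∈ S → Adjacent x y → deg G S y ≡ 1)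

    ∈IEv⇔ : x ∈ IEv G S ⇔ OnIsolatedEdge x
    ∈IEv⇔ {x} = mk⇔ on-edge ∈IEv
      where
      nbr-deg≡1 : Fin n → Bool
      nbr-deg≡1 y = if lookup S y ∧ adj G x y then deg G S y ≡ᵇ 1 else true

      on-edge : x ∈ IEv G S → OnIsolatedEdge x
      on-edge x∈ with x∈S , rest ← Equivalence.to T-∧ (∈-tabulate⁻ x∈)
                 with deg≡1 , nbrs ← Equivalence.to T-∧ rest =
        Equivalence.from ∈⇔T-lookup x∈S , ≡ᵇ⇒≡ _ 1 deg≡1 , λ {y} y∈S xy →
          ≡ᵇ⇒≡ _ 1 (subst (λ b → T (if b then deg G S y ≡ᵇ 1 else true))
                          (cong₂ _∧_ ([]=⇒lookup y∈S) xy) (Equivalence.to (T-allFinB nbr-deg≡1) nbrs y))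

      ∈IEv : OnIsolatedEdge x → x ∈ IEv G S
      ∈IEv (x∈S , deg≡1 , nbr-deg) = ∈-tabulate⁺ (Equivalence.from T-∧ (Equivalence.to ∈⇔T-lookup x∈S ,
        Equivalence.from T-∧ (≡⇒≡ᵇ _ 1 deg≡1 , Equivalence.from (T-allFinB nbr-deg≡1) nbr-ok)))
        where
        nbr-ok : ∀ y → T (nbr-deg≡1 y)
        nbr-ok y with lookup S y in y∈S | adj G x y in xy
        ... | true  | true  = ≡⇒≡ᵇ _ 1 (nbr-deg (lookup⇒[]= y S y∈S) xy)
        ... | true  | false = _
        ... | false | _     = _

    Iset⊆S : x ∈ Iset G S → x ∈ S
    Iset⊆S x∈ with x∈p∪q⁻ (Iso G S) (IEv G S) x∈
    ... | inj₁ x∈Iso = proj₁ (∈Iso⁻ x∈Iso)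
    ... | inj₂ x∈IEv = proj₁ (Equivalence.to ∈IEv⇔ x∈IEv)

    Iset-deg≤1 : x ∈ Iset G S → deg G S x ≤ 1
    Iset-deg≤1 x∈ with x∈p∪q⁻ (Iso G S) (IEv G S) x∈
    ... | inj₁ x∈Iso = ≤-trans (≤-reflexive (proj₂ (∈Iso⁻ x∈Iso))) z≤n
    ... | inj₂ x∈IEv = ≤-reflexive (proj₁ (proj₂ (Equivalence.to ∈IEv⇔ x∈IEv)))

    ComponentClosed : Subset n → Set
    ComponentClosed C = ∀ {x y} → x ∈ S → y ∈ S → Adjacent x y → x ∈ C → y ∈ C

    Iset-closed : ComponentClosed (Iset G S)
    Iset-closed {x} {y} x∈S y∈S xy x∈ with x∈p∪q⁻ (Iso G S) (IEv G S) x∈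
    ... | inj₁ x∈Iso = contradiction x∈Iso (not-isolated y∈S xy)
    ... | inj₂ x∈IEv with _ , deg-x≡1 , nbr-deg≡1 ← Equivalence.to ∈IEv⇔ x∈IEv =
      x∈p∪q⁺ (inj₂ (Equivalence.from ∈IEv⇔ (y∈S , nbr-deg≡1 y∈S xy , λ z∈S yz →
        subst (λ z → deg G S z ≡ 1) (deg≡1⇒unique-nbr (nbr-deg≡1 y∈S xy) x∈S z∈S (adjacent-sym xy) yz) deg-x≡1)))

    closed-chain : ∀ {C xs} → ComponentClosed C → Chain G xs → All (_∈ S) xs → Any (_∈ C) xs → All (_∈ C) xs
    closed-chain closed chain[ _ ]    _                         (here x∈C) = x∈C ∷ []
    closed-chain closed (chain∷ xy c) (x∈S ∷ ys⊆S@(y∈S ∷ _)) (here x∈C) =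
      x∈C ∷ closed-chain closed c ys⊆S (here (closed x∈S y∈S xy x∈C))
    closed-chain closed (chain∷ xy c) (x∈S ∷ ys⊆S@(y∈S ∷ _)) (there some)
      with ys⊆C@(y∈C ∷ _) ← closed-chain closed c ys⊆S some =
      closed y∈S x∈S (adjacent-sym xy) y∈C ∷ ys⊆C

    -- Path covers of G[S]

    InducedPath : List (Fin n) → Set
    InducedPath xs = Chain G xs × Unique xs × All (_∈ S) xs

    deg<2⇒endpoint : ∀ {a xs v} → InducedPath (a ∷ xs) → v ∈ₗ a ∷ xs → deg G S v < 2 → v ≡ a ⊎ v ≡ last′ a xs
    deg<2⇒endpoint _ (here refl) _ = inj₁ refl
    deg<2⇒endpoint (chain∷ _ c , _ ∷ !xs , _ ∷ xs⊆S) (there v∈) deg<2 with deg<2⇒endpoint (c , !xs , xs⊆S) v∈ deg<2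
    ... | inj₂ v≡last = inj₂ v≡last
    deg<2⇒endpoint {xs = _ ∷ []}    _ (there _) _ | inj₁ refl = inj₂ refl
    deg<2⇒endpoint {xs = _ ∷ _ ∷ _} (chain∷ ab (chain∷ bc _) , (_ ∷ a≢c ∷ _) ∷ _ , a∈S ∷ _ ∷ c∈S ∷ _) (there _) deg<2
      | inj₁ refl = contradiction (2≤deg a∈S c∈S (adjacent-sym ab) bc a≢c) (<⇒≱ deg<2)

    cover-path : ∀ {ps xs} → PathCover G S ps → xs ∈ₗ ps → InducedPath xs
    cover-path (_ , chains , !ps , covers) xs∈ =
      All.lookup chains xs∈ , Unique-concat⁻ !ps xs∈ , All.tabulate λ v∈ → Equivalence.to (covers _) (∈-concat⁺′ v∈ xs∈)

    covering-path : ∀ {ps} → PathCover G S ps → x ∈ S → ∃[ xs ] xs ∈ₗ ps × x ∈ₗ xs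
    covering-path {ps = ps} (_ , _ , _ , covers) x∈S
      with xs , x∈xs , xs∈ ← ∈-concat⁻′ ps (Equivalence.from (covers _) x∈S) = xs , xs∈ , x∈xs

    ∣V₁∣≤2*paths : ∀ {ps} → PathCover G S ps → ∣ V₁ G S ∣ ≤ 2 * length ps
    ∣V₁∣≤2*paths {ps} cover = ≤-trans (∣p∣≤length (V₁ G S) (endpoints ps) V₁⊆endpoints) (length-endpoints ps)
      where
      V₁⊆endpoints : ∀ {v} → v ∈ V₁ G S → v ∈ₗ endpoints ps
      V₁⊆endpoints v∈V₁ with v∈S , deg≡1 ← ∈V₁⁻ v∈V₁ with covering-path cover v∈S
      ... | _ ∷ _ , xs∈ , v∈xs = ∈-endpoints xs∈ (deg<2⇒endpoint (cover-path cover xs∈) v∈xs (≤-reflexive (cong suc deg≡1)))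

    avoiding-cover : ∀ {C ps} → ComponentClosed C → PathCover G S ps →
                     PathCover G (S ─ C) (filter (∁? (any? (_∈? C))) ps)
    avoiding-cover {C} {ps} closed cover@(nonempty , chains , !ps , covers) =
      All.filter⁺ avoids? nonempty , All.filter⁺ avoids? chains ,
      subst Unique (sym concat≡) (Unique.filter⁺ (∁? (_∈? C)) !ps) ,
      λ v → subst (λ vs → v ∈ₗ vs ⇔ v ∈ S ─ C) (sym concat≡) (members v)
      where
      avoids? : Decidable (λ xs → ¬ Any (_∈ C) xs)
      avoids? = ∁? (any? (_∈? C))

      concat≡ : concat (filter avoids? ps) ≡ filter (∁? (_∈? C)) (concat ps)
      concat≡ = concat-filter-∁-any (_∈? C) ps (All.tabulate λ xs∈ →
        let chain , _ , xs⊆S = cover-path cover xs∈ in closed-chain closed chain xs⊆S)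

      members : ∀ v → v ∈ₗ filter (∁? (_∈? C)) (concat ps) ⇔ v ∈ S ─ C
      members v = mk⇔
        (λ v∈ → let v∈ps , v∉C = ∈-filter⁻ (∁? (_∈? C)) v∈ in x∈p∧x∉q⇒x∈p─q (Equivalence.to (covers v) v∈ps) v∉C)
        (λ v∈S─C → ∈-filter⁺ (∁? (_∈? C)) (Equivalence.from (covers v) (p─q⊆p S C v∈S─C)) (x∈p─q⇒x∉q v∈S─C))

    -- Isolated vertices weigh 2 and vertices of isolated edges weigh 1: a path inside I(G[S])
    -- weighs at most 2, and Icount is half the total weight.
    isolated-path-weight : ∀ {xs} → InducedPath xs → All (_∈ Iset G S) xs →
                           2 * count∈ (Iso G S) xs + count∈ (IEv G S) xs ≤ 2
    isolated-path-weight {[]} _ _ = z≤n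
    isolated-path-weight {x ∷ []} _ _ with x ∈? Iso G S | x ∈? IEv G S
    ... | yes x∈Iso | yes x∈IEv =
      contradiction (trans (sym (proj₂ (∈Iso⁻ x∈Iso))) (proj₁ (proj₂ (Equivalence.to ∈IEv⇔ x∈IEv)))) λ ()
    ... | yes _     | no  _     = ≤-refl
    ... | no  _     | yes _     = s≤s z≤n
    ... | no  _     | no  _     = z≤n
    isolated-path-weight {x ∷ y ∷ []} (chain∷ xy _ , _ , x∈S ∷ y∈S ∷ []) _
      rewrite filter-none (_∈? Iso G S) (not-isolated y∈S xy ∷ not-isolated x∈S (adjacent-sym xy) ∷ []) =
      length-filter (_∈? IEv G S) (x ∷ y ∷ [])
    isolated-path-weight {x ∷ y ∷ z ∷ _} (chain∷ xy (chain∷ yz _) , (_ ∷ x≢z ∷ _) ∷ _ , x∈S ∷ _ ∷ z∈S ∷ _)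
                         (_ ∷ y∈Iset ∷ _) =
      contradiction (2≤deg x∈S z∈S (adjacent-sym xy) yz x≢z) (<⇒≱ (s≤s (Iset-deg≤1 y∈Iset)))

    Icount≤meeting-paths : ∀ {ps} → PathCover G S ps → Icount G S ≤ length (filter (any? (_∈? Iset G S)) ps)
    Icount≤meeting-paths {ps} cover = 2*a+b≤2*q⇒a+b/2≤q ∣ Iso G S ∣ ∣ IEv G S ∣ (length meeting) (begin
      2 * ∣ Iso G S ∣ + ∣ IEv G S ∣
        ≤⟨ +-mono-≤ (*-monoʳ-≤ 2 (∣p∣≤count∈ _ _ (Iset⊆meeting ∘ x∈p∪q⁺ ∘ inj₁)))
                    (∣p∣≤count∈ _ _ (Iset⊆meeting ∘ x∈p∪q⁺ ∘ inj₂)) ⟩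
      2 * count∈ (Iso G S) (concat meeting) + count∈ (IEv G S) (concat meeting)
        ≤⟨ weighted-count-concat _ _ meeting weight ⟩
      2 * length meeting ∎)
      where
      open ≤-Reasoning
      meeting : List (List (Fin n))
      meeting = filter (any? (_∈? Iset G S)) ps

      Iset⊆meeting : ∀ {v} → v ∈ Iset G S → v ∈ₗ concat meeting
      Iset⊆meeting v∈I with xs , xs∈ , v∈xs ← covering-path cover (Iset⊆S v∈I) =
        ∈-concat⁺′ v∈xs (∈-filter⁺ (any? (_∈? Iset G S)) xs∈ (lose v∈xs v∈I))

      weight : ∀ {xs} → xs ∈ₗ meeting → 2 * count∈ (Iso G S) xs + count∈ (IEv G S) xs ≤ 2
      weight xs∈ with xs∈ps , meets ← ∈-filter⁻ (any? (_∈? Iset G S)) xs∈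
                 with path@(chain , _ , xs⊆S) ← cover-path cover xs∈ps =
        isolated-path-weight path (closed-chain Iset-closed chain xs⊆S meets)

  KValue≤length-cover : ∀ {S m ps} → KValue G S m → PathCover G S ps → m ≤ length ps
  KValue≤length-cover (k-empty _) _ = z≤n
  KValue≤length-cover {S} (k-noI (x , x∈S) _) cover =
    ⊔-lub (nonempty (covering-path S cover x∈S)) (m≤2*q⇒⌈m/2⌉≤q _ _ (∣V₁∣≤2*paths S cover))
    where
    nonempty : ∀ {ps} → ∃[ xs ] xs ∈ₗ ps × x ∈ₗ xs → 1 ≤ length ps
    nonempty (_ , here _  , _) = s≤s z≤n
    nonempty (_ , there _ , _) = s≤s z≤n
  KValue≤length-cover {S} {ps = ps} (k-I {m = m} _ k) cover = begin
    Icount G S + m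
      ≤⟨ +-mono-≤ (Icount≤meeting-paths S cover) (KValue≤length-cover k (avoiding-cover S (Iset-closed S) cover)) ⟩
    length (filter (any? (_∈? Iset G S)) ps) + length (filter (∁? (any? (_∈? Iset G S))) ps)
      ≡⟨ length-filter+length-filter-∁ (any? (_∈? Iset G S)) ps ⟩
    length ps ∎
    where open ≤-Reasoning

  -- Cutting a Hamiltonian cycle

  hamiltonian-path : ∀ {T y} → Hamiltonian G T → y ∈ T →
                     ∃[ ys ] Chain G (y ∷ ys) × Unique (y ∷ ys) × (∀ v → v ∈ₗ y ∷ ys ⇔ v ∈ T)
  hamiltonian-path {T} {y} (x , xs , !cycle , members , _ , cycle) y∈T
    with as , bs , cycle≡ ← ∈-∃++ (Equivalence.from (members y) y∈T) =
    bs ++ as , chain-rotate as y bs cycle≡ cycle , Unique-resp-↭ rotation (subst Unique cycle≡ !cycle) , members′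
    where
    rotation : as ++ y ∷ bs ↭ y ∷ bs ++ as
    rotation = ++-comm as (y ∷ bs)

    members′ : ∀ v → v ∈ₗ y ∷ bs ++ as ⇔ v ∈ T
    members′ v = mk⇔ (Equivalence.to (members v) ∘ subst (v ∈ₗ_) (sym cycle≡) ∘ ∈-resp-↭ (↭-sym rotation))
                     (∈-resp-↭ rotation ∘ subst (v ∈ₗ_) cycle≡ ∘ Equivalence.from (members v))

  small-path-cover : ∀ {W X v₀} → X ≡ ∁ W → 1 < ∣ X ∣ → v₀ ∈ X → Hamiltonian G (⊤ - v₀) →
                     ∃[ ps ] PathCover G W ps × length ps < ∣ X ∣
  small-path-cover {W} {X} {v₀} refl 1<∣X∣ v₀∈X hamiltonian
    with y , y∈X , y≢v₀ ← 1<∣p∣⇒∃x≢y X v₀ 1<∣X∣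
    with ys , chain , !path@(_ ∷ !ys) , members ← hamiltonian-path hamiltonian (x∈p∧x≢y⇒x∈p-y ∈⊤ y≢v₀) =
    ps , (nonempty , chains , unique , covers) , bound
    where
    ps : List (List (Fin n))
    ps = blocks (_∈? X) ys

    on-path⇒≢v₀ : ∀ {v} → v ∈ₗ y ∷ ys → v ≢ v₀
    on-path⇒≢v₀ {v} v∈ = x∉⁅y⁆⇒x≢y (x∈p─q⇒x∉q (Equivalence.to (members v) v∈))

    nonempty : All (NonEmptyList G) ps
    nonempty = blocks-nonempty (_∈? X) _ ys

    chains : All (Chain G) ps
    chains = blocks-infix (_∈? X) chain[] (λ {xs} → chain-++⁻ˡ xs) (λ {x} → chain-++⁻ʳ [ x ]) (chain-++⁻ʳ [ y ] chain)

    unique : Unique (concat ps)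
    unique = subst Unique (sym (concat-blocks (_∈? X) ys)) (Unique.filter⁺ (∁? (_∈? X)) !ys)

    covers : ∀ v → v ∈ₗ concat ps ⇔ v ∈ W
    covers v = subst (λ vs → v ∈ₗ vs ⇔ v ∈ W) (sym (concat-blocks (_∈? X) ys)) (mk⇔
      (x∉∁p⇒x∈p ∘ proj₂ ∘ ∈-filter⁻ (∁? (_∈? X)) {xs = ys})
      λ v∈W → ∈-filter⁺ (∁? (_∈? X)) (on-path v∈W) (x∈p⇒x∉∁p v∈W))
      where
      on-path : v ∈ W → v ∈ₗ ys
      on-path v∈W with Equivalence.from (members v) (x∈p∧x≢y⇒x∈p-y ∈⊤ λ { refl → x∈p⇒x∉∁p v∈W v₀∈X })
      ... | here refl  = contradiction y∈X (x∈p⇒x∉∁p v∈W)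
      ... | there v∈ys = v∈ys

    bound : length ps < ∣ X ∣
    bound = begin-strict
      length ps                        ≤⟨ length-blocks (_∈? X) ys ⟩
      suc (count∈ X ys)                ≡⟨ cong length (filter-accept (_∈? X) y∈X) ⟨
      count∈ X (y ∷ ys)                ≤⟨ Unique⇒length≤∣p∣ (Unique.filter⁺ (_∈? X) !path) (All.tabulate ∈X-v₀) ⟩
      ∣ X - v₀ ∣                       <⟨ x∈p⇒∣p-x∣<∣p∣ v₀∈X ⟩
      ∣ X ∣                            ∎
      where
      open ≤-Reasoning
      ∈X-v₀ : ∀ {v} → v ∈ₗ filter (_∈? X) (y ∷ ys) → v ∈ X - v₀
      ∈X-v₀ v∈ with v∈path , v∈X ← ∈-filter⁻ (_∈? X) v∈ = x∈p∧x≢y⇒x∈p-y v∈X (on-path⇒≢v₀ v∈path)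

lemma3p1 : ∀ {n} (G : Graph n) (w : Fin n) → AlmostHypocyclicWith G w →
    (W X : Subset n) → X ≡ ∁ W → 1 < ∣ W ∣ → 1 < ∣ X ∣ →
    (∀ m → PathCoverNumber G W m → m < ∣ X ∣) × (∀ m → KValue G W m → m < ∣ X ∣)
lemma3p1 G w (_ , vertex-deleted-hamiltonian) W X X≡∁W _ 1<∣X∣
  with v₀ , v₀∈X , v₀≢w ← 1<∣p∣⇒∃x≢y X w 1<∣X∣
  with ps , cover , ps<∣X∣ ← small-path-cover G X≡∁W 1<∣X∣ v₀∈X (vertex-deleted-hamiltonian v₀ v₀≢w) =
  (λ _ (_ , minimal) → ≤-<-trans (minimal ps cover) ps<∣X∣) ,
  (λ _ k → ≤-<-trans (KValue≤length-cover G k cover) ps<∣X∣)
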